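{- Let $\mathcal{G}$ be a class of graphs closed under vertex-disjoint unions, and let $k,c\ge 1$ be integers. If some $G\in\mathcal{G}$ is $k$-connected and has exactly $k+c$ vertices, then $x_{\mathcal{G},c}\le \frac{c}{k+c}$.
   Context: All graphs are finite, simple and undirected. For a graph $G=(V,E)$ and a positive integer $c$, a set $S\subseteq V$ is a $c$-clustered set if every connected component of $G[S]$ has at most $c$ vertices; $\alpha_c(G)$ is the maximum size of a $c$-clustered set in $G$. For a graph class $\mathcal{G}$, $x_{\mathcal{G},c}=\liminf\{\alpha_c(G)/|V(G)|\colon G\in\mathcal{G}\}$, i.e. the limit inferior, as the number of vertices grows, of the ratio $\alpha_c(G)/|V(G)|$ over graphs in $\mathcal{G}$. -}

module Defs where

open import Data.Nat using (ℕ; suc; _+_; _*_; _≤_; _<_)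
open import Data.Bool using (Bool; true; false)
open import Data.Fin using (Fin; splitAt)
open import Data.Fin.Subset using (Subset; _∈_; _∉_; ∣_∣; ∁)
open import Data.Sum using (_⊎_; inj₁; inj₂)
open import Data.Product using (Σ; _×_; _,_; ∃)
open import Data.List using (List; length)
open import Data.List.Relation.Unary.All using (All)
open import Data.List.Relation.Unary.Unique.Propositional using (Unique)
open import Relation.Binary.PropositionalEquality using (_≡_; refl)

record Graph : Set where
  field
    order  : ℕ
    adj    : Fin order → Fin order → Bool
    sym    : ∀ i j → adj i j ≡ adj j i
    irrefl : ∀ i → adj i i ≡ false
open Graph public

⊕adj : (G H : Graph) → Fin (order G + order H) → Fin (order G + order H) → Bool
⊕adj G H x y with splitAt (order G) x | splitAt (order G) y
... | inj₁ i | inj₁ j = adj G i j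
... | inj₂ i | inj₂ j = adj H i j
... | inj₁ _ | inj₂ _ = false
... | inj₂ _ | inj₁ _ = false

⊕sym : (G H : Graph) → ∀ x y → ⊕adj G H x y ≡ ⊕adj G H y x
⊕sym G H x y with splitAt (order G) x | splitAt (order G) y
... | inj₁ i | inj₁ j = sym G i j
... | inj₂ i | inj₂ j = sym H i j
... | inj₁ _ | inj₂ _ = refl
... | inj₂ _ | inj₁ _ = refl

⊕irrefl : (G H : Graph) → ∀ x → ⊕adj G H x x ≡ false
⊕irrefl G H x with splitAt (order G) x
... | inj₁ i = irrefl G i
... | inj₂ i = irrefl H i

_⊕_ : Graph → Graph → Graph
G ⊕ H = record
  { order = order G + order H
  ; adj = ⊕adj G H
  ; sym = ⊕sym G H
  ; irrefl = ⊕irrefl G H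
  }

ClosedUnderDisjointUnion : (Graph → Set) → Set
ClosedUnderDisjointUnion 𝒢 = ∀ G H → 𝒢 G → 𝒢 H → 𝒢 (G ⊕ H)

data Reach (G : Graph) (S : Subset (order G)) : Fin (order G) → Fin (order G) → Set where
  here : ∀ {u} → u ∈ S → Reach G S u u
  step : ∀ {u w v} → u ∈ S → adj G u w ≡ true → Reach G S w v → Reach G S u v

ConnectedOn : (G : Graph) → Subset (order G) → Set
ConnectedOn G S = ∀ u v → u ∈ S → v ∈ S → Reach G S u v

KConnected : Graph → ℕ → Set
KConnected G k = (k < order G) × (∀ (X : Subset (order G)) → ∣ X ∣ < k → ConnectedOn G (∁ X))

-- S is c-clustered: the component of G[S] containing any v ∈ S has at most
-- c vertices (every duplicate-free list of vertices reachable from v in G[S]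
-- has length ≤ c).
Clustered : (G : Graph) → ℕ → Subset (order G) → Set
Clustered G c S = ∀ v → v ∈ S → (l : List (Fin (order G))) → Unique l → All (Reach G S v) l → length l ≤ c

IsAlpha : Graph → ℕ → ℕ → Set
IsAlpha G c a = (Σ (Subset (order G)) λ S → Clustered G c S × ∣ S ∣ ≡ a)
              × (∀ S → Clustered G c S → ∣ S ∣ ≤ a)

-- x_{𝒢,c} ≤ p / q  (q ≥ 1), i.e. liminf_{|V(G)|→∞, G ∈ 𝒢} α_c(G)/|V(G)| ≤ p/q.
-- Unfolded: for every N and every ε = 1/(m+1) there is G ∈ 𝒢 with
-- |V(G)| ≥ N and α_c(G)/|V(G)| < p/q + 1/(m+1), cleared of denominators.
LiminfRatioLE : (Graph → Set) → ℕ → ℕ → ℕ → Set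
LiminfRatioLE 𝒢 c p q =
  ∀ (N m : ℕ) → ∃ λ G → 𝒢 G × N ≤ order G ×
    (∀ a → IsAlpha G c a → a * q * suc m < p * suc m * order G + q * order G)

-- In a k-connected graph on k + c vertices, the complement of a set S with
-- more than c vertices has fewer than k vertices, so G[S] is connected and S
-- is not c-clustered: α_c(G) ≤ c. A c-clustered set of a disjoint union
-- restricts to a c-clustered set of each part, so t disjoint copies of G have
-- α_c ≤ t c on t (k + c) vertices, and these graphs lie in the class.
module Submission where

open import Defs
open import Data.Nat using (ℕ; zero; suc; _+_; _*_; _∸_; _≤_; _<_; z≤n; z<s; _≤?_; >-nonZero)
open import Data.Nat.Properties
open import Data.Nat.Tactic.RingSolver using (solve-∀)
open import Data.Bool using (true)
open import Data.Fin using (Fin; _↑ˡ_; _↑ʳ_)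
import Data.Fin as Fin
open import Data.Fin.Properties using (↑ˡ-injective; ↑ʳ-injective; splitAt-↑ˡ; splitAt-↑ʳ)
  renaming (suc-injective to Fin-suc-injective)
open import Data.Fin.Subset using (Subset; _∈_; _⊆_; ∣_∣; ∁; inside; outside)
open import Data.Fin.Subset.Properties
  using (x∈p⇒x∉∁p; x∈∁p⇒x∉p; x∉∁p⇒x∈p; x∉p⇒x∈∁p; ∣∁p∣≡n∸∣p∣; ∣p∣≤n; nonempty?; Empty-unique; ∣⊥∣≡0)
open import Data.Vec using ([]; _∷_; _++_)
import Data.Vec as Vec
open import Data.Vec.Properties using (lookup-++ˡ; lookup-++ʳ; []=⇒lookup; lookup⇒[]=)
open import Data.List using (List; length; map)
import Data.List as List
open import Data.List.Properties using (length-map)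
open import Data.List.Relation.Unary.All using (All)
import Data.List.Relation.Unary.All as All
import Data.List.Relation.Unary.All.Properties as All
open import Data.List.Relation.Unary.AllPairs using (AllPairs)
open import Data.List.Relation.Unary.Unique.Propositional using (Unique)
import Data.List.Relation.Unary.Unique.Propositional.Properties as Unique
open import Data.Product using (∃; _×_; _,_)
open import Function using (id)
open import Function.Definitions using (Injective)
open import Relation.Nullary using (yes; no)
open import Relation.Binary.PropositionalEquality using (_≡_; refl; trans; cong; subst)
import Relation.Binary.PropositionalEquality as ≡

private
  variable
    n : ℕ

elements : Subset n → List (Fin n)
elements []            = List.[]
elements (inside ∷ p)  = Fin.zero List.∷ map Fin.suc (elements p)
elements (outside ∷ p) = map Fin.suc (elements p)

length-elements : (p : Subset n) → length (elements p) ≡ ∣ p ∣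
length-elements []            = refl
length-elements (inside ∷ p)  = cong suc (trans (length-map Fin.suc (elements p)) (length-elements p))
length-elements (outside ∷ p) = trans (length-map Fin.suc (elements p)) (length-elements p)

elements-⊆ : (p : Subset n) → All (_∈ p) (elements p)
elements-⊆ []            = All.[]
elements-⊆ (inside ∷ p)  = Vec.here All.∷ All.map⁺ (All.map Vec.there (elements-⊆ p))
elements-⊆ (outside ∷ p) = All.map⁺ (All.map Vec.there (elements-⊆ p))

elements-unique : (p : Subset n) → Unique (elements p)
elements-unique []            = AllPairs.[]
elements-unique (inside ∷ p)  =
  All.map⁺ (All.universal (λ _ ()) (elements p)) AllPairs.∷ Unique.map⁺ Fin-suc-injective (elements-unique p)
elements-unique (outside ∷ p) = Unique.map⁺ Fin-suc-injective (elements-unique p)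

Reach-map : ∀ {G H : Graph} {S : Subset (order G)} {T : Subset (order H)}
            (f : Fin (order G) → Fin (order H)) →
            (∀ {u w} → adj G u w ≡ true → adj H (f u) (f w) ≡ true) →
            (∀ {x} → x ∈ S → f x ∈ T) →
            ∀ {u v} → Reach G S u v → Reach H T (f u) (f v)
Reach-map f f-adj f-∈ (here u∈S)          = here (f-∈ u∈S)
Reach-map f f-adj f-∈ (step u∈S uw reach) = step (f-∈ u∈S) (f-adj uw) (Reach-map f f-adj f-∈ reach)

record Embedding (G H : Graph) : Set where
  field
    embed     : Fin (order G) → Fin (order H)
    injective : Injective _≡_ _≡_ embed
    embed-adj : ∀ {u w} → adj G u w ≡ true → adj H (embed u) (embed w) ≡ true
open Embedding

Clustered-pullback : ∀ {G H c} {S : Subset (order G)} {T : Subset (order H)} (e : Embedding G H) →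
                     (∀ {x} → x ∈ S → embed e x ∈ T) → Clustered H c T → Clustered G c S
Clustered-pullback {c = c} e e-∈ clustered v v∈S l l-unique l-reach =
  subst (_≤ c) (length-map (embed e) l)
    (clustered (embed e v) (e-∈ v∈S) (map (embed e) l)
      (Unique.map⁺ (injective e) l-unique)
      (All.map⁺ (All.map (Reach-map (embed e) (embed-adj e) e-∈) l-reach)))

⊕-embeddingˡ : ∀ G H → Embedding G (G ⊕ H)
⊕-embeddingˡ G H = record
  { embed     = _↑ˡ order H
  ; injective = ↑ˡ-injective (order H) _ _
  ; embed-adj = λ {u} {w} uw → trans (⊕adj-↑ˡ u w) uw
  }
  where
  ⊕adj-↑ˡ : ∀ u w → ⊕adj G H (u ↑ˡ order H) (w ↑ˡ order H) ≡ adj G u w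
  ⊕adj-↑ˡ u w rewrite splitAt-↑ˡ (order G) u (order H) | splitAt-↑ˡ (order G) w (order H) = refl

⊕-embeddingʳ : ∀ G H → Embedding H (G ⊕ H)
⊕-embeddingʳ G H = record
  { embed     = order G ↑ʳ_
  ; injective = ↑ʳ-injective (order G) _ _
  ; embed-adj = λ {u} {w} uw → trans (⊕adj-↑ʳ u w) uw
  }
  where
  ⊕adj-↑ʳ : ∀ u w → ⊕adj G H (order G ↑ʳ u) (order G ↑ʳ w) ≡ adj H u w
  ⊕adj-↑ʳ u w rewrite splitAt-↑ʳ (order G) (order H) u | splitAt-↑ʳ (order G) (order H) w = refl

module _ {m n} (p : Subset m) (q : Subset n) where

  ∈-++⁺ˡ : ∀ {x} → x ∈ p → x ↑ˡ n ∈ p ++ q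
  ∈-++⁺ˡ {x} x∈p = lookup⇒[]= _ (p ++ q) (trans (lookup-++ˡ p q x) ([]=⇒lookup x∈p))

  ∈-++⁺ʳ : ∀ {x} → x ∈ q → m ↑ʳ x ∈ p ++ q
  ∈-++⁺ʳ {x} x∈q = lookup⇒[]= _ (p ++ q) (trans (lookup-++ʳ p q x) ([]=⇒lookup x∈q))

∣p++q∣ : ∀ {m n} (p : Subset m) (q : Subset n) → ∣ p ++ q ∣ ≡ ∣ p ∣ + ∣ q ∣
∣p++q∣ []            q = refl
∣p++q∣ (inside ∷ p)  q = cong suc (∣p++q∣ p q)
∣p++q∣ (outside ∷ p) q = ∣p++q∣ p q

ClusteredBound : Graph → ℕ → ℕ → Set
ClusteredBound G c a = ∀ S → Clustered G c S → ∣ S ∣ ≤ a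

⊕-ClusteredBound : ∀ {G H c a b} → ClusteredBound G c a → ClusteredBound H c b →
                   ClusteredBound (G ⊕ H) c (a + b)
⊕-ClusteredBound {G} {H} {c} {a} {b} boundG boundH S clustered with Vec.splitAt (order G) S
... | p , q , refl = subst (_≤ a + b) (≡.sym (∣p++q∣ p q))
  (+-mono-≤ (boundG p (Clustered-pullback (⊕-embeddingˡ G H) (∈-++⁺ˡ p q) clustered))
            (boundH q (Clustered-pullback (⊕-embeddingʳ G H) (∈-++⁺ʳ p q) clustered)))

KConnected⇒ConnectedOn : ∀ {G k} → KConnected G k → (S : Subset (order G)) → ∣ ∁ S ∣ < k → ConnectedOn G S
KConnected⇒ConnectedOn {G} (_ , connected) S ∣∁S∣<k u v u∈S v∈S =
  Reach-map id id ∁∁S⊆S (connected (∁ S) ∣∁S∣<k u v (S⊆∁∁S u∈S) (S⊆∁∁S v∈S))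
  where
  S⊆∁∁S : S ⊆ ∁ (∁ S)
  S⊆∁∁S x∈S = x∉p⇒x∈∁p (x∈p⇒x∉∁p x∈S)
  ∁∁S⊆S : ∁ (∁ S) ⊆ S
  ∁∁S⊆S x∈∁∁S = x∉∁p⇒x∈p (x∈∁p⇒x∉p x∈∁∁S)

ConnectedOn∧Clustered⇒∣S∣≤c : ∀ {G c} (S : Subset (order G)) → ConnectedOn G S → Clustered G c S → ∣ S ∣ ≤ c
ConnectedOn∧Clustered⇒∣S∣≤c {G} S connected clustered with nonempty? S
... | no  S-empty   = subst (_≤ _) (≡.sym (trans (cong ∣_∣ (Empty-unique S-empty)) (∣⊥∣≡0 (order G)))) z≤n
... | yes (v , v∈S) = subst (_≤ _) (length-elements S)
  (clustered v v∈S (elements S) (elements-unique S)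
    (All.map (λ x∈S → connected v _ v∈S x∈S) (elements-⊆ S)))

KConnected⇒ClusteredBound : ∀ {G k c} → KConnected G k → order G ≤ k + c → ClusteredBound G c c
KConnected⇒ClusteredBound {G} {k} {c} k-connected order≤k+c S clustered with ∣ S ∣ ≤? c
... | yes ∣S∣≤c = ∣S∣≤c
... | no  ∣S∣≰c = ConnectedOn∧Clustered⇒∣S∣≤c S (KConnected⇒ConnectedOn k-connected S ∣∁S∣<k) clustered
  where
  open ≤-Reasoning
  ∣∁S∣<k : ∣ ∁ S ∣ < k
  ∣∁S∣<k = begin-strict
    ∣ ∁ S ∣           ≡⟨ ∣∁p∣≡n∸∣p∣ S ⟩
    order G ∸ ∣ S ∣   <⟨ ∸-monoˡ-< (≤-<-trans order≤k+c (+-monoʳ-< k (≰⇒> ∣S∣≰c))) (∣p∣≤n S) ⟩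
    k + ∣ S ∣ ∸ ∣ S ∣ ≡⟨ m+n∸n≡m k ∣ S ∣ ⟩
    k                 ∎

-- copies t G is the disjoint union of t + 1 copies of G, so that no empty graph is needed.
copies : ℕ → Graph → Graph
copies zero    G = G
copies (suc t) G = G ⊕ copies t G

copies-∈ : ∀ {𝒢 : Graph → Set} → ClosedUnderDisjointUnion 𝒢 → ∀ {G} → 𝒢 G → ∀ t → 𝒢 (copies t G)
copies-∈ closed G∈𝒢 zero    = G∈𝒢
copies-∈ closed G∈𝒢 (suc t) = closed _ _ G∈𝒢 (copies-∈ closed G∈𝒢 t)

order-copies : ∀ t G → order (copies t G) ≡ suc t * order G
order-copies zero    G = ≡.sym (+-identityʳ (order G))
order-copies (suc t) G = cong (order G +_) (order-copies t G)

copies-ClusteredBound : ∀ {G c a} → ClusteredBound G c a → ∀ t → ClusteredBound (copies t G) c (suc t * a)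
copies-ClusteredBound {a = a} bound zero    = subst (ClusteredBound _ _) (≡.sym (+-identityʳ a)) bound
copies-ClusteredBound         bound (suc t) = ⊕-ClusteredBound bound (copies-ClusteredBound bound t)

-- Already a q ≤ c O for O = (t + 1) q; the ε-term q O only makes the inequality strict.
ratio-bound : ∀ a c q t m → 0 < q → a ≤ suc t * c →
              a * q * suc m < c * suc m * (suc t * q) + q * (suc t * q)
ratio-bound a c q t m 0<q a≤[1+t]c = begin-strict
  a * q * suc m                             ≤⟨ *-monoˡ-≤ (suc m) (*-monoˡ-≤ q a≤[1+t]c) ⟩
  suc t * c * q * suc m                     ≡⟨ rearrange (suc t) c q (suc m) ⟩
  c * suc m * (suc t * q)                   <⟨ m<m+n _ (*-mono-< 0<q 0<[1+t]q) ⟩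
  c * suc m * (suc t * q) + q * (suc t * q) ∎
  where
  open ≤-Reasoning
  rearrange : ∀ s c q m → s * c * q * m ≡ c * m * (s * q)
  rearrange = solve-∀
  0<[1+t]q : 0 < suc t * q
  0<[1+t]q = *-mono-< {0} {suc t} z<s 0<q

lemma13 : (𝒢 : Graph → Set) → ClosedUnderDisjointUnion 𝒢 → (k c : ℕ) → 1 ≤ k → 1 ≤ c →
          (∃ λ G → 𝒢 G × KConnected G k × order G ≡ k + c) →
          LiminfRatioLE 𝒢 c c (k + c)
lemma13 𝒢 closed k c 1≤k _ (G , G∈𝒢 , k-connected , order≡k+c) N m =
  copies N G , copies-∈ closed G∈𝒢 N , N≤order , α-bound
  where
  q : ℕ
  q = k + c
  0<q : 0 < q
  0<q = ≤-trans 1≤k (m≤m+n k c)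
  order≡[1+N]q : order (copies N G) ≡ suc N * q
  order≡[1+N]q = trans (order-copies N G) (cong (suc N *_) order≡k+c)
  N≤order : N ≤ order (copies N G)
  N≤order = subst (N ≤_) (≡.sym order≡[1+N]q) (≤-trans (n≤1+n N) (m≤m*n (suc N) q {{ >-nonZero 0<q }}))
  α-bound : ∀ a → IsAlpha (copies N G) c a → a * q * suc m < c * suc m * order (copies N G) + q * order (copies N G)
  α-bound a ((S , S-clustered , refl) , _) =
    subst (λ O → ∣ S ∣ * q * suc m < c * suc m * O + q * O) (≡.sym order≡[1+N]q) (ratio-bound ∣ S ∣ c q N m 0<q
      (copies-ClusteredBound (KConnected⇒ClusteredBound k-connected (≤-reflexive order≡k+c)) N S S-clustered))
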